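{- (1) For every ED frame $F$ there exists a full system $S$ such that $F(S)$ is isomorphic to $F$. (2) For every EDI frame $F$ there exists a hypercube $S$ such that $F(S)$ is isomorphic to $F$.
   Context: Frames $(W,\sim_1,\dots,\sim_n)$, $W$ nonempty. ED frame: all $\sim_i$ equivalence relations and directed (for any $w_1,\dots,w_n$ there is $\overline w$ with $w_i\sim_i\overline w$ for all $i$). EDI frame: ED frame with $\bigcap_i\sim_i$ equal to the identity on $W$. A system of global states is a nonempty $S\subseteq L_e\times L_1\times\dots\times L_n$ ($L_e,L_i$ nonempty); $F(S)=(S,\sim_1,\dots,\sim_n)$ with $(l_e,l_1,\dots,l_n)\sim_i(l'_e,l'_1,\dots,l'_n)$ iff $l_i=l'_i$. $S$ is full if each $\langle l_1,\dots,l_n\rangle\in L_1\times\dots\times L_n$ has some $s\in L_e$ with $\langle s,l_1,\dots,l_n\rangle\in S$. A hypercube is $L_e\times L_1\times\dots\times L_n$ with $L_e$ a singleton and the $L_i$ nonempty. Frames are isomorphic if there is a bijection $h$ between worlds with $w\sim_iw'$ iff $h(w)\sim'_ih(w')$ for all $i$. -}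

module Defs where

open import Data.Nat using (ℕ)
open import Data.Fin using (Fin)
open import Data.Product using (Σ; ∃; _×_; _,_; proj₁; proj₂)
open import Relation.Binary using (Rel; IsEquivalence; Setoid)
open import Relation.Binary.PropositionalEquality using (_≡_)
open import Function using (_⇔_)
open import Level using (0ℓ)

record Frame (n : ℕ) : Set₁ where
  field
    W        : Set
    nonempty : W
    _∼[_]_   : W → Fin n → W → Set

open Frame

IsED : ∀ {n} → Frame n → Set
IsED {n} F =
  ((i : Fin n) → IsEquivalence (λ w w′ → _∼[_]_ F w i w′)) ×
  ((ws : Fin n → W F) → ∃ λ w̄ → (i : Fin n) → _∼[_]_ F (ws i) i w̄)

IsEDI : ∀ {n} → Frame n → Set
IsEDI {n} F = IsED F × (∀ w w′ → ((i : Fin n) → _∼[_]_ F w i w′) ⇔ (w ≡ w′))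

-- Systems of global states.  Since Agda has no quotient types, the sets
-- of local states L_e, L_i are setoids (a set with its equality).

record LocalStates (n : ℕ) : Set₁ where
  field
    Le  : Setoid 0ℓ 0ℓ
    L   : Fin n → Setoid 0ℓ 0ℓ
    le₀ : Setoid.Carrier Le
    l₀  : (i : Fin n) → Setoid.Carrier (L i)

  Global : Set
  Global = Setoid.Carrier Le × ((i : Fin n) → Setoid.Carrier (L i))

  _≈G_ : Global → Global → Set
  (e , l) ≈G (e′ , l′) = Setoid._≈_ Le e e′ × ((i : Fin n) → Setoid._≈_ (L i) (l i) (l′ i))

open LocalStates public

record System (n : ℕ) : Set₁ where
  field
    LS       : LocalStates n
    S        : Global LS → Set
    S-resp   : ∀ {g g′} → _≈G_ LS g g′ → S g → S g′
    S-inhab  : ∃ λ g → S g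

  World : Set
  World = Σ (Global LS) S

  _≈W_ : World → World → Set
  s ≈W s′ = _≈G_ LS (proj₁ s) (proj₁ s′)

  _∼S[_]_ : World → Fin n → World → Set
  s ∼S[ i ] s′ = Setoid._≈_ (L LS i) (proj₂ (proj₁ s) i) (proj₂ (proj₁ s′) i)

open System public

IsFull : ∀ {n} → System n → Set
IsFull {n} Sys =
  (l : (i : Fin n) → Setoid.Carrier (L (LS Sys) i)) →
  ∃ λ s → S Sys (s , l)

IsHypercube : ∀ {n} → System n → Set
IsHypercube {n} Sys =
  (∀ (e e′ : Setoid.Carrier (Le (LS Sys))) → Setoid._≈_ (Le (LS Sys)) e e′) ×
  (∀ (g : Global (LS Sys)) → S Sys g)

Isomorphic : ∀ {n} → System n → Frame n → Set
Isomorphic {n} Sys F =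
  Σ (W F → World Sys) λ h →
    (∀ w w′ → _≈W_ Sys (h w) (h w′) → w ≡ w′) ×
    (∀ s → ∃ λ w → _≈W_ Sys (h w) s) ×
    (∀ w w′ (i : Fin n) → _∼[_]_ F w i w′ ⇔ _∼S[_]_ Sys (h w) i (h w′))

-- Let the local states of agent i be the worlds up to ∼ᵢ, i.e. the classes
-- of W/∼ᵢ, and send a world w to the global state whose every local state is
-- the class of w; then ∼ᵢ corresponds to agreement of the i-th local states
-- by construction.  For (1) the environment state is w itself, which makes
-- the map injective, and S consists of those ⟨e, l₁, …, lₙ⟩ with e in every
-- class lᵢ: fullness of S is then literally directedness.  For (2) the
-- environment is trivial and S is the whole hypercube; injectivity is
-- ⋂ᵢ ∼ᵢ = id, and surjectivity is again directedness.
module Submission where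

open import Defs
open import Data.Nat using (ℕ)
open import Data.Fin using (Fin)
open import Data.Product using (Σ; ∃; _×_; _,_)
open import Data.Unit using (⊤; tt)
open import Relation.Binary using (Setoid; IsEquivalence)
open import Relation.Binary.PropositionalEquality using (_≡_; refl; setoid)
open import Function using (mk⇔; id; Equivalence)
open import Level using (0ℓ)

module _ {n : ℕ} (F : Frame n) where

  open Frame F

  Directed : Set
  Directed = (ws : Fin n → W) → ∃ λ w̄ → (i : Fin n) → ws i ∼[ i ] w̄

  Separating : Set
  Separating = ∀ w w′ → ((i : Fin n) → w ∼[ i ] w′) → w ≡ w′

module _ {n : ℕ} (F : Frame n)
         (∼-equiv : (i : Fin n) → IsEquivalence (λ w w′ → Frame._∼[_]_ F w i w′)) where

  open Frame F
  private module ∼ (i : Fin n) = IsEquivalence (∼-equiv i)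

  classes : Fin n → Setoid 0ℓ 0ℓ
  classes i = record { Carrier = W ; _≈_ = λ w w′ → w ∼[ i ] w′ ; isEquivalence = ∼-equiv i }

  classStates : (Le : Setoid 0ℓ 0ℓ) → Setoid.Carrier Le → LocalStates n
  classStates Le e₀ = record { Le = Le ; L = classes ; le₀ = e₀ ; l₀ = λ _ → nonempty }

  fullSystem : System n
  fullSystem = record
    { LS      = classStates (setoid W) nonempty
    ; S       = λ (e , l) → (i : Fin n) → l i ∼[ i ] e
    ; S-resp  = λ { (refl , l≈l′) l∼e i → ∼.trans i (∼.sym i (l≈l′ i)) (l∼e i) }
    ; S-inhab = (nonempty , λ _ → nonempty) , λ i → ∼.refl i
    }

  fullSystem-isFull : Directed F → IsFull fullSystem
  fullSystem-isFull directed = directed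

  fullSystem-isomorphic : Isomorphic fullSystem F
  fullSystem-isomorphic = embed , injective , surjective , λ _ _ _ → mk⇔ id id
    where
    embed : W → World fullSystem
    embed w = (w , λ _ → w) , λ i → ∼.refl i

    injective : ∀ w w′ → _≈W_ fullSystem (embed w) (embed w′) → w ≡ w′
    injective _ _ (w≡w′ , _) = w≡w′

    surjective : ∀ s → ∃ λ w → _≈W_ fullSystem (embed w) s
    surjective ((e , l) , l∼e) = e , refl , λ i → ∼.sym i (l∼e i)

  hypercube : System n
  hypercube = record
    { LS      = classStates (setoid ⊤) tt
    ; S       = λ _ → ⊤
    ; S-resp  = λ _ _ → tt
    ; S-inhab = (tt , λ _ → nonempty) , tt
    }

  hypercube-isHypercube : IsHypercube hypercube
  hypercube-isHypercube = (λ _ _ → refl) , λ _ → tt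

  hypercube-isomorphic : Directed F → Separating F → Isomorphic hypercube F
  hypercube-isomorphic directed separating = embed , injective , surjective , λ _ _ _ → mk⇔ id id
    where
    embed : W → World hypercube
    embed w = (tt , λ _ → w) , tt

    injective : ∀ w w′ → _≈W_ hypercube (embed w) (embed w′) → w ≡ w′
    injective w w′ (_ , w∼w′) = separating w w′ w∼w′

    surjective : ∀ s → ∃ λ w → _≈W_ hypercube (embed w) s
    surjective ((_ , l) , _) with directed l
    ... | w̄ , l∼w̄ = w̄ , refl , λ i → ∼.sym i (l∼w̄ i)

lemma3p2 : ((n : ℕ) (F : Frame n) → IsED F → Σ (System n) λ S → IsFull S × Isomorphic S F)
    × ((n : ℕ) (F : Frame n) → IsEDI F → Σ (System n) λ S → IsHypercube S × Isomorphic S F)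
lemma3p2 = fromED , fromEDI
  where
  fromED : (n : ℕ) (F : Frame n) → IsED F → Σ (System n) λ S → IsFull S × Isomorphic S F
  fromED _ F (∼-equiv , directed) =
    fullSystem F ∼-equiv , fullSystem-isFull F ∼-equiv directed , fullSystem-isomorphic F ∼-equiv

  fromEDI : (n : ℕ) (F : Frame n) → IsEDI F → Σ (System n) λ S → IsHypercube S × Isomorphic S F
  fromEDI _ F ((∼-equiv , directed) , identity) =
    hypercube F ∼-equiv , hypercube-isHypercube F ∼-equiv ,
    hypercube-isomorphic F ∼-equiv directed (λ w w′ → Equivalence.to (identity w w′))
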